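{- Define maps on pairs of integers $(d,m)$ with $d\neq 0$ by $L(d,m) = (d, m+d)$ and $R(d,m) = \left(\frac{(m+d)^2+1}{d},\ m + \frac{m^2+1}{d}\right)$. Consider the infinite rooted binary tree whose root is labeled by the pair $(1,0)$ and in which every node labeled $(d,m)$ has a left child labeled $L(d,m)$ and a right child labeled $R(d,m)$. Suppose $d,m$ are integers with $d\geq 1$, $m\geq 0$, and $d$ divides $m^2+1$. Then the pair $(d,m)$ appears as the label of exactly one node of this tree. -}

module Defs where

open import Data.Integer using (ℤ; +_; _+_; _*_; 0ℤ; 1ℤ)
open import Data.Integer.DivMod using (_/_; _%_)
open import Data.Nat as ℕ using (ℕ)
open import Data.Product using (_×_; _,_)
open import Data.List using (List; []; _∷_)
open import Data.Maybe using (Maybe; just; nothing; _>>=_)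

-- Exact integer division: defined (just q) only when d ≠ 0 and d ∣ a,
-- in which case q * d ≡ a.  (Used to render the fractions in R, which the
-- paper only applies where they are integers.)
exactDiv : ℤ → ℤ → Maybe ℤ
exactDiv a (+ ℕ.zero) = nothing
exactDiv a d@(+ ℕ.suc _) with a % d
... | ℕ.zero = just (a / d)
... | ℕ.suc _ = nothing
exactDiv a d@(Data.Integer.-[1+ _ ]) with a % d
... | ℕ.zero = just (a / d)
... | ℕ.suc _ = nothing

Lmap : ℤ × ℤ → ℤ × ℤ
Lmap (d , m) = (d , m + d)

Rmap : ℤ × ℤ → Maybe (ℤ × ℤ)
Rmap (d , m) =
  exactDiv ((m + d) * (m + d) + 1ℤ) d >>= λ a →
  exactDiv (m * m + 1ℤ) d >>= λ b →
  just (a , m + b)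

-- A node of the infinite rooted binary tree = the path from the root.
data Dir : Set where
  left right : Dir

Node : Set
Node = List Dir

labelFrom : ℤ × ℤ → Node → Maybe (ℤ × ℤ)
labelFrom p [] = just p
labelFrom p (left ∷ ns) = labelFrom (Lmap p) ns
labelFrom p (right ∷ ns) = Rmap p >>= λ q → labelFrom q ns

label : Node → Maybe (ℤ × ℤ)
label = labelFrom (1ℤ , 0ℤ)

-- Record a pair (d, m) with d ∣ m² + 1 as the triple (d, m, e) with d e = m² + 1.
-- On triples L becomes (d, m, e) ↦ (d, m + d, (m + d) + (m + e)), and R is L conjugated by
-- the symmetry (d, m, e) ↦ (e, m, d).  A left child satisfies d ≤ m < e and a right child
-- e ≤ m, so no triple is a child in two ways; conversely, by (m + 1)² > m² + 1, every triple
-- with m > 0 has d ≤ m or e ≤ m and is therefore the child of a triple with smaller m.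
-- Descent in m reaches (1, 0, 1) from every triple, which gives existence; and since a
-- triple determines which kind of child it is and its parent, the path to a node is
-- determined by its label, which gives uniqueness.
module Submission where

open import Defs

module TripleTree where

  open import Data.Empty using (⊥-elim)
  open import Data.Integer as ℤ using (ℤ; 1ℤ)
  import Data.Integer.Properties as ℤ
  open import Data.List using (List; []; _∷_; _∷ʳ_; foldl; foldr; reverse)
  open import Data.List.Properties using (foldl-∷ʳ; reverse-foldl; reverse-injective; reverse-involutive)
  open import Data.Maybe using (just; _>>=_)
  open import Data.Maybe.Properties using (just-injective)
  open import Data.Nat
  open import Data.Nat.DivMod using (m*n%n≡0; m*n/n≡m)
  open import Data.Nat.Induction using (<-wellFounded)
  open import Data.Nat.Properties
  open import Data.Nat.Tactic.RingSolver using (solve-∀)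
  open import Data.Product using (Σ; _×_; _,_)
  open import Data.Sum using (_⊎_; inj₁; inj₂)
  open import Function using (flip)
  open import Induction.WellFounded using (Acc; acc)
  open import Relation.Binary.PropositionalEquality
  open import Relation.Nullary using (yes; no; contradiction)

  record Triple : Set where
    constructor ⟨_,_,_⟩
    field
      d m e : ℕ

  open Triple

  record Factorises (t : Triple) : Set where
    constructor factorises
    field
      d*e≡m*m+1 : d t * e t ≡ m t * m t + 1

  root : Triple
  root = ⟨ 1 , 0 , 1 ⟩

  swap : Triple → Triple
  swap ⟨ d , m , e ⟩ = ⟨ e , m , d ⟩

  descendLeft : Triple → Triple
  descendLeft ⟨ d , m , e ⟩ = ⟨ d , m + d , m + d + (m + e) ⟩

  child : Triple → Dir → Triple
  child t left  = descendLeft t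
  child t right = swap (descendLeft (swap t))

  tripleAt : Node → Triple
  tripleAt = foldl child root

  pair : Triple → ℤ × ℤ
  pair t = ℤ.+ d t , ℤ.+ m t

  factorises-swap : ∀ {t} → Factorises t → Factorises (swap t)
  factorises-swap {⟨ d , m , e ⟩} (factorises f) = factorises (trans (*-comm e d) f)

  factorises-descendLeft : ∀ {t} → Factorises t → Factorises (descendLeft t)
  factorises-descendLeft {⟨ d , m , e ⟩} (factorises f) = factorises (begin
    d * (m + d + (m + e))              ≡⟨ expand d m e ⟩
    d * (m + d) + d * m + d * e        ≡⟨ cong ((d * (m + d) + d * m) +_) f ⟩
    d * (m + d) + d * m + (m * m + 1)  ≡⟨ square d m ⟩
    (m + d) * (m + d) + 1              ∎)
    where
    open ≡-Reasoning
    expand : ∀ d m e → d * (m + d + (m + e)) ≡ d * (m + d) + d * m + d * e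
    expand = solve-∀
    square : ∀ d m → d * (m + d) + d * m + (m * m + 1) ≡ (m + d) * (m + d) + 1
    square = solve-∀

  factorises-child : ∀ {t} → Factorises t → ∀ x → Factorises (child t x)
  factorises-child f left  = factorises-descendLeft f
  factorises-child f right = factorises-swap (factorises-descendLeft (factorises-swap f))

  factorises-foldl : ∀ {t} → Factorises t → ∀ v → Factorises (foldl child t v)
  factorises-foldl f []      = f
  factorises-foldl f (x ∷ v) = factorises-foldl (factorises-child f x) v

  factorises-tripleAt : ∀ v → Factorises (tripleAt v)
  factorises-tripleAt = factorises-foldl (factorises refl)

  factorises⇒d>0 : ∀ {t} → Factorises t → 0 < d t
  factorises⇒d>0 {⟨ zero , m , e ⟩}  (factorises f) = contradiction (m+n≡0⇒n≡0 (m * m) (sym f)) λ ()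
  factorises⇒d>0 {⟨ suc _ , _ , _ ⟩} _ = z<s

  factorises⇒e>0 : ∀ {t} → Factorises t → 0 < e t
  factorises⇒e>0 f = factorises⇒d>0 (factorises-swap f)

  pair-injective : ∀ {s t} → Factorises s → Factorises t → pair s ≡ pair t → s ≡ t
  pair-injective {⟨ d , m , e ⟩} {⟨ _ , _ , e′ ⟩} f@(factorises de) (factorises de′) refl =
    cong ⟨ d , m ,_⟩ (*-cancelˡ-≡ e e′ d {{>-nonZero (factorises⇒d>0 f)}} (trans de (sym de′)))

  descendLeft-injective : ∀ {s t} → descendLeft s ≡ descendLeft t → s ≡ t
  descendLeft-injective {⟨ d , m , e ⟩} {⟨ d′ , m′ , e′ ⟩} eq
    with refl ← cong Triple.d eq
    with refl ← +-cancelʳ-≡ d m m′ (cong Triple.m eq)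
    with refl ← +-cancelˡ-≡ m e e′ (+-cancelˡ-≡ (m + d) (m + e) (m + e′) (cong Triple.e eq))
    = refl

  child-injective : ∀ {s t} x → child s x ≡ child t x → s ≡ t
  child-injective left  eq = descendLeft-injective eq
  child-injective right eq = cong swap (descendLeft-injective (cong swap eq))

  m<m-child : ∀ {t} → Factorises t → ∀ x → m t < m (child t x)
  m<m-child {t} f left  = m<m+n (m t) (factorises⇒d>0 f)
  m<m-child {t} f right = m<m+n (m t) (factorises⇒e>0 f)

  root≢child : ∀ {t} → Factorises t → ∀ x → root ≢ child t x
  root≢child f x eq = n≮0 (subst (_ <_) (cong Triple.m (sym eq)) (m<m-child f x))

  m<e-left : ∀ {t} → Factorises t → m (child t left) < e (child t left)
  m<e-left {t} f = m<m+n (m t + d t) (<-≤-trans (factorises⇒e>0 f) (m≤n+m (e t) (m t)))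

  e≤m-right : ∀ t → e (child t right) ≤ m (child t right)
  e≤m-right t = m≤n+m (e t) (m t)

  left≢right : ∀ {s t} → Factorises s → child s left ≢ child t right
  left≢right {s} {t} f eq = <⇒≱ (m<e-left f) (begin
    e (child s left)   ≡⟨ cong e eq ⟩
    e (child t right)  ≤⟨ e≤m-right t ⟩
    m (child t right)  ≡⟨ cong m eq ⟨
    m (child s left)   ∎)
    where open ≤-Reasoning

  -- climb (reverse v) is tripleAt v, computed so that the last step of the path comes first.
  climb : List Dir → Triple
  climb = foldr (flip child) root

  factorises-climb : ∀ ys → Factorises (climb ys)
  factorises-climb ys = subst Factorises (reverse-foldl child root ys) (factorises-tripleAt (reverse ys))

  climb-injective : ∀ xs ys → climb xs ≡ climb ys → xs ≡ ys
  climb-injective []           []           _  = refl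
  climb-injective []           (y ∷ ys)     eq = ⊥-elim (root≢child (factorises-climb ys) y eq)
  climb-injective (x ∷ xs)     []           eq = ⊥-elim (root≢child (factorises-climb xs) x (sym eq))
  climb-injective (left ∷ xs)  (left ∷ ys)  eq = cong (left ∷_) (climb-injective xs ys (child-injective left eq))
  climb-injective (right ∷ xs) (right ∷ ys) eq = cong (right ∷_) (climb-injective xs ys (child-injective right eq))
  climb-injective (left ∷ xs)  (right ∷ ys) eq = ⊥-elim (left≢right (factorises-climb xs) eq)
  climb-injective (right ∷ xs) (left ∷ ys)  eq = ⊥-elim (left≢right (factorises-climb ys) (sym eq))

  tripleAt-injective : ∀ {v w} → tripleAt v ≡ tripleAt w → v ≡ w
  tripleAt-injective {v} {w} eq = reverse-injective (climb-injective (reverse v) (reverse w) (begin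
    climb (reverse v)               ≡⟨ reverse-foldl child root (reverse v) ⟨
    tripleAt (reverse (reverse v))  ≡⟨ cong tripleAt (reverse-involutive v) ⟩
    tripleAt v                      ≡⟨ eq ⟩
    tripleAt w                      ≡⟨ cong tripleAt (reverse-involutive w) ⟨
    tripleAt (reverse (reverse w))  ≡⟨ reverse-foldl child root (reverse w) ⟩
    climb (reverse w)               ∎))
    where open ≡-Reasoning

  m*m+1<[1+m]*[1+m] : ∀ {m} → 0 < m → m * m + 1 < suc m * suc m
  m*m+1<[1+m]*[1+m] {m} m>0 =
    subst (m * m + 1 <_) (expand m) (m<m+n (m * m + 1) (<-≤-trans m>0 (m≤m+n m m)))
    where
    expand : ∀ m → m * m + 1 + (m + m) ≡ (1 + m) * (1 + m)
    expand = solve-∀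

  cofactor-of-excess : ∀ {d e c n} → d * e ≡ d * c + n → 0 < n →
                       Σ ℕ λ j → e ≡ c + j × d * j ≡ n
  cofactor-of-excess {d} {e} {c} {n} de n>0 = e ∸ c , sym c+[e∸c]≡e , +-cancelˡ-≡ (d * c) _ _ (begin
    d * c + d * (e ∸ c)  ≡⟨ *-distribˡ-+ d c (e ∸ c) ⟨
    d * (c + (e ∸ c))    ≡⟨ cong (d *_) c+[e∸c]≡e ⟩
    d * e                ≡⟨ de ⟩
    d * c + n            ∎)
    where
    open ≡-Reasoning
    c<e : c < e
    c<e = *-cancelˡ-< d c e (<-≤-trans (m<m+n (d * c) n>0) (≤-reflexive (sym de)))
    c+[e∸c]≡e : c + (e ∸ c) ≡ e
    c+[e∸c]≡e = m+[n∸m]≡n (<⇒≤ c<e)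

  leftParent : ∀ {t} → Factorises t → d t ≤ m t → Σ Triple λ p → Factorises p × child p left ≡ t
  leftParent {⟨ d , m , e ⟩} (factorises de) d≤m with m ∸ d | m∸n+n≡m d≤m
  ... | k | refl =
    let j , e≡ , dj = cofactor-of-excess {d} {c = k + d + k} (trans de (expand d k)) (m≤n+m 1 (k * k))
    in ⟨ d , k , j ⟩ , factorises dj , cong ⟨ d , k + d ,_⟩ (sym (trans e≡ (+-assoc (k + d) k j)))
    where
    expand : ∀ d k → (k + d) * (k + d) + 1 ≡ d * (k + d + k) + (k * k + 1)
    expand = solve-∀

  rightParent : ∀ {t} → Factorises t → e t ≤ m t → Σ Triple λ p → Factorises p × child p right ≡ t
  rightParent f e≤m with p , fp , eq ← leftParent (factorises-swap f) e≤m =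
    swap p , factorises-swap fp , cong swap eq

  HasParent : Triple → Set
  HasParent t = Σ Triple λ p → Factorises p × Σ Dir λ x → child p x ≡ t

  root-or-child : ∀ {t} → Factorises t → t ≡ root ⊎ HasParent t
  root-or-child {⟨ d , zero , e ⟩} (factorises de) =
    inj₁ (cong₂ ⟨_, 0 ,_⟩ (m*n≡1⇒m≡1 d e de) (m*n≡1⇒n≡1 d e de))
  root-or-child {⟨ d , suc k , e ⟩} f@(factorises de) with d ≤? suc k | e ≤? suc k
  ... | yes d≤m | _ = let p , fp , eq = leftParent f d≤m in inj₂ (p , fp , left , eq)
  ... | no _ | yes e≤m = let p , fp , eq = rightParent f e≤m in inj₂ (p , fp , right , eq)
  ... | no d≰m | no e≰m = ⊥-elim (<⇒≱ (m*m+1<[1+m]*[1+m] z<s)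
    (≤-trans (*-mono-≤ (≰⇒> d≰m) (≰⇒> e≰m)) (≤-reflexive de)))

  Reachable : Triple → Set
  Reachable t = Σ Node λ v → tripleAt v ≡ t

  reachable : ∀ {t} → Factorises t → Reachable t
  reachable f = descend f (<-wellFounded _)
    where
    descend : ∀ {t} → Factorises t → Acc _<_ (m t) → Reachable t
    descend f (acc rec) with root-or-child f
    ... | inj₁ refl = [] , refl
    ... | inj₂ (p , fp , x , refl) with v , refl ← descend fp (rec (m<m-child fp x)) =
      v ∷ʳ x , foldl-∷ʳ child root x v

  exactDiv-exact : ∀ {a n} q → q * suc n ≡ a → exactDiv (ℤ.+ a) (ℤ.+ suc n) ≡ just (ℤ.+ q)
  exactDiv-exact {n = n} q refl rewrite m*n%n≡0 q (suc n) {{_}} =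
    cong just (trans (ℤ.*-identityˡ _) (cong ℤ.+_ (m*n/n≡m q (suc n))))

  pos-square+1 : ∀ a → ℤ.+ a ℤ.* ℤ.+ a ℤ.+ 1ℤ ≡ ℤ.+ (a * a + 1)
  pos-square+1 a = trans (cong (ℤ._+ 1ℤ) (sym (ℤ.pos-* a a))) (sym (ℤ.pos-+ (a * a) 1))

  -- R's first entry ((m + d)² + 1) / d is the last entry of the left child.
  d-right*d≡[m+d]²+1 : ∀ {t} → Factorises t → d (child t right) * d t ≡ (m t + d t) * (m t + d t) + 1
  d-right*d≡[m+d]²+1 {t} f = trans (*-comm _ (d t))
    (trans (cong (d t *_) (+-comm (m t + e t) (m t + d t))) (Factorises.d*e≡m*m+1 (factorises-descendLeft f)))

  Rmap-pair : ∀ {t} → Factorises t → Rmap (pair t) ≡ just (pair (child t right))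
  Rmap-pair {⟨ zero , m , e ⟩} f = contradiction (factorises⇒d>0 f) λ ()
  Rmap-pair {⟨ d@(suc _) , m , e ⟩} f@(factorises de)
    rewrite pos-square+1 (m + d) | pos-square+1 m
          | exactDiv-exact (m + e + (m + d)) (d-right*d≡[m+d]²+1 f)
          | exactDiv-exact e (trans (*-comm e d) de) = refl

  labelFrom-pair : ∀ {t} → Factorises t → ∀ v → labelFrom (pair t) v ≡ just (pair (foldl child t v))
  labelFrom-pair f []          = refl
  labelFrom-pair f (left ∷ v)  = labelFrom-pair (factorises-child f left) v
  labelFrom-pair f (right ∷ v) rewrite Rmap-pair f = labelFrom-pair (factorises-child f right) v

  label-tripleAt : ∀ v → label v ≡ just (pair (tripleAt v))
  label-tripleAt = labelFrom-pair (factorises refl)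

  unique-node : ∀ {t} → Factorises t →
    Σ Node λ v → label v ≡ just (pair t) × ∀ w → label w ≡ just (pair t) → w ≡ v
  unique-node f with v , refl ← reachable f = v , label-tripleAt v , λ w lw →
    tripleAt-injective (pair-injective (factorises-tripleAt w) f
      (just-injective (trans (sym (label-tripleAt w)) lw)))

open import Data.Integer using (ℤ; _≤_; _+_; _*_; 1ℤ; 0ℤ; +_; +≤+; ∣_∣)
open import Data.Integer.Divisibility using (_∣_; divides)
open import Data.Nat as ℕ using (zero; suc)
import Data.Nat.Properties as ℕ
open import Data.Product using (Σ; _×_; _,_)
open import Data.Maybe using (just)
open import Relation.Binary.PropositionalEquality using (_≡_; cong; module ≡-Reasoning)
open TripleTree using (factorises; pos-square+1; unique-node)

lemma6 : (d m : ℤ) → 1ℤ ≤ d → 0ℤ ≤ m → d ∣ (m * m + 1ℤ) →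
    Σ Node (λ v → (label v ≡ just (d , m)) ×
    ((w : Node) → label w ≡ just (d , m) → w ≡ v))
lemma6 (+ zero)  _       (+≤+ ()) _ _
lemma6 (+ suc k) (+ n) _ _ (divides e n²+1≡e*d) = unique-node (factorises (begin
  suc k ℕ.* e         ≡⟨ ℕ.*-comm (suc k) e ⟩
  e ℕ.* suc k         ≡⟨ n²+1≡e*d ⟨
  ∣ + n * + n + 1ℤ ∣  ≡⟨ cong ∣_∣ (pos-square+1 n) ⟩
  n ℕ.* n ℕ.+ 1       ∎))
  where open ≡-Reasoning
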